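{- DBFOL does not enjoy the finite-model property: there exist a language signature $\Sigma$, a set of variables $\mathrm{Var}$, and a DBFOL sentence over $\Sigma(\mathrm{Var})$ that is satisfiable but has no finite model.
   Context: A language signature is a triple $\Sigma=(\mathrm{Args},\mathrm{Rels},\mathrm{ar})$ where $\mathrm{Args},\mathrm{Rels}$ are finite non-empty sets and $\mathrm{ar}:\mathrm{Rels}\to\mathcal P(\mathrm{Args})\setminus\{\emptyset\}$. A $\Sigma$-structure is $\mathcal R=(D,\cdot^{\mathcal R})$ with $D$ non-empty and $r^{\mathcal R}$ a set of functions $\mathrm{ar}(r)\to D$ for each $r\in\mathrm{Rels}$; it is finite iff $D$ is finite. FOL formulas over $\Sigma(\mathrm{Var})$ ($\mathrm{Var}$ an enumerable set of variables): $\varphi::= r\mid\neg\varphi\mid\varphi\wedge\varphi\mid\varphi\vee\varphi\mid\exists x.\varphi\mid\forall x.\varphi\mid(a,x)\varphi$. Free placeholders: $\mathrm{free}(r)=\mathrm{ar}(r)$, unchanged by $\neg$, union for $\wedge,\vee$, $\mathrm{free}(Qx.\varphi)=\mathrm{free}(\varphi)\setminus\{x\}$, $\mathrm{free}((a,x)\varphi)=(\mathrm{free}(\varphi)\setminus\{a\})\cup\{x\}$ if $a\in\mathrm{free}(\varphi)$ and $\mathrm{free}(\varphi)$ otherwise; a sentence has no free placeholders. Semantics w.r.t. partial assignments $\chi:\mathrm{Args}\cup\mathrm{Var}\rightharpoonup D$: $\mathcal R,\chi\models r$ iff $\chi|_{\mathrm{ar}(r)}\in r^{\mathcal R}$; Boolean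 connectives and quantifiers as usual (quantifiers update the variable in $\chi$); $\mathcal R,\chi\models(a,x)\varphi$ iff $\mathcal R,\chi[a\mapsto\chi(x)]\models\varphi$. A structure is a model of a sentence $\varphi$ iff $\mathcal R,\emptyset\models\varphi$; satisfiable means having a model. A quantification prefix is a finite word over $\{\exists x,\forall x\}$ with each variable at most once; a binding prefix is a finite word over pairs $(a,x)$ with each argument at most once; a derived relation is a Boolean combination of relations all having the same argument set. DBFOL formulas: $\varphi::=\wp\psi\mid\varphi\wedge\varphi\mid\varphi\vee\varphi$, $\psi::=\flat\bar r\mid\psi\vee\psi$, with $\wp$ a quantification prefix, $\flat$ a binding prefix, $\bar r$ a derived relation. -}

module Defs where

open import Data.Nat using (ℕ; _≤_)
import Data.Nat as ℕ
open import Data.Fin using (Fin)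
import Data.Fin as F
open import Data.Fin.Subset using (Subset; _∈_; Nonempty)
open import Data.Maybe using (Maybe; just; nothing)
open import Data.Product using (Σ; ∃; _×_; _,_; proj₁; proj₂)
open import Data.Sum using (_⊎_)
open import Data.Empty using (⊥)
open import Data.List using (List; []; _∷_; map)
open import Data.List.Relation.Unary.All using (All)
open import Data.List.Relation.Unary.Unique.Propositional using (Unique)
open import Relation.Nullary using (¬_; does)
open import Relation.Binary.PropositionalEquality using (_≡_; _≢_)
open import Data.Bool using (if_then_else_)
open import Function.Bundles using (_↔_)

record Signature : Set where
  field
    nA : ℕ
    nR : ℕ
    Args-nonempty : 1 ≤ nA
    Rels-nonempty : 1 ≤ nR
    ar : Fin nR → Subset nA
    ar-nonempty : ∀ r → Nonempty (ar r)

Var : Set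
Var = ℕ

module _ (Sig : Signature) where
  open Signature Sig

  Args : Set
  Args = Fin nA

  Rels : Set
  Rels = Fin nR

  -- Σ-structures: r^R is a set (predicate) of functions ar(r) → D
  record Structure : Set₁ where
    field
      D : Set
      inhabited : D
      rel : (r : Rels) → ((a : Args) → a ∈ ar r → D) → Set

  Finite : Structure → Set
  Finite R = ∃ λ n → Structure.D R ↔ Fin n

  data Formula : Set where
    rel  : Rels → Formula
    ¬'   : Formula → Formula
    _∧'_ : Formula → Formula → Formula
    _∨'_ : Formula → Formula → Formula
    ∃'   : Var → Formula → Formula
    ∀'   : Var → Formula → Formula
    bind : Args → Var → Formula → Formula

  FreeArg : Formula → Args → Set
  FreeVar : Formula → Var → Set
  FreeArg (rel r) b = b ∈ ar r
  FreeArg (¬' φ) b = FreeArg φ b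
  FreeArg (φ ∧' ψ) b = FreeArg φ b ⊎ FreeArg ψ b
  FreeArg (φ ∨' ψ) b = FreeArg φ b ⊎ FreeArg ψ b
  FreeArg (∃' x φ) b = FreeArg φ b
  FreeArg (∀' x φ) b = FreeArg φ b
  -- if a ∈ free φ: (free φ ∖ {a}) ∪ {x}; otherwise free φ (which coincides
  -- with free φ ∖ {a} on arguments in that case)
  FreeArg (bind a x φ) b = FreeArg φ b × b ≢ a
  FreeVar (rel r) y = ⊥
  FreeVar (¬' φ) y = FreeVar φ y
  FreeVar (φ ∧' ψ) y = FreeVar φ y ⊎ FreeVar ψ y
  FreeVar (φ ∨' ψ) y = FreeVar φ y ⊎ FreeVar ψ y
  FreeVar (∃' x φ) y = FreeVar φ y × y ≢ x
  FreeVar (∀' x φ) y = FreeVar φ y × y ≢ x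
  FreeVar (bind a x φ) y = FreeVar φ y ⊎ (y ≡ x × FreeArg φ a)

  IsSentence : Formula → Set
  IsSentence φ = (∀ a → ¬ FreeArg φ a) × (∀ x → ¬ FreeVar φ x)

  record Assignment (D : Set) : Set where
    constructor ⟨_,_⟩
    field
      onArgs : Args → Maybe D
      onVars : Var → Maybe D

  emptyAssignment : ∀ {D} → Assignment D
  emptyAssignment = ⟨ (λ _ → nothing) , (λ _ → nothing) ⟩

  updArg : ∀ {D} → Assignment D → Args → Maybe D → Assignment D
  updArg ⟨ χa , χv ⟩ a m = ⟨ (λ b → if does (b F.≟ a) then m else χa b) , χv ⟩

  updVar : ∀ {D} → Assignment D → Var → Maybe D → Assignment D
  updVar ⟨ χa , χv ⟩ x m = ⟨ χa , (λ y → if does (y ℕ.≟ x) then m else χv y) ⟩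

  _,_⊨_ : (R : Structure) → Assignment (Structure.D R) → Formula → Set
  R , χ ⊨ rel r = Σ ((a : Args) → a ∈ ar r → Structure.D R) λ f →
                    Structure.rel R r f ×
                    (∀ a (p : a ∈ ar r) → Assignment.onArgs χ a ≡ just (f a p))
  R , χ ⊨ ¬' φ = ¬ (R , χ ⊨ φ)
  R , χ ⊨ (φ ∧' ψ) = (R , χ ⊨ φ) × (R , χ ⊨ ψ)
  R , χ ⊨ (φ ∨' ψ) = (R , χ ⊨ φ) ⊎ (R , χ ⊨ ψ)
  R , χ ⊨ ∃' x φ = Σ (Structure.D R) λ d → R , updVar χ x (just d) ⊨ φ
  R , χ ⊨ ∀' x φ = (d : Structure.D R) → R , updVar χ x (just d) ⊨ φ
  R , χ ⊨ bind a x φ = R , updArg χ a (Assignment.onVars χ x) ⊨ φ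

  IsModel : Structure → Formula → Set
  IsModel R φ = R , emptyAssignment ⊨ φ

  Satisfiable : Formula → Set₁
  Satisfiable φ = Σ Structure λ R → IsModel R φ

  HasFiniteModel : Formula → Set₁
  HasFiniteModel φ = Σ Structure λ R → Finite R × IsModel R φ

  data Q : Set where
    ∃q ∀q : Q

  QPrefix : Set
  QPrefix = Σ (List (Q × Var)) λ w → Unique (map proj₂ w)

  BPrefix : Set
  BPrefix = Σ (List (Args × Var)) λ w → Unique (map proj₁ w)

  data BoolComb : Set where
    atom : Rels → BoolComb
    ¬b   : BoolComb → BoolComb
    _∧b_ : BoolComb → BoolComb → BoolComb
    _∨b_ : BoolComb → BoolComb → BoolComb

  AllArgsEq : Subset nA → BoolComb → Set
  AllArgsEq S (atom r) = ar r ≡ S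
  AllArgsEq S (¬b b) = AllArgsEq S b
  AllArgsEq S (b ∧b c) = AllArgsEq S b × AllArgsEq S c
  AllArgsEq S (b ∨b c) = AllArgsEq S b × AllArgsEq S c

  DerivedRel : Set
  DerivedRel = Σ BoolComb λ b → ∃ λ S → AllArgsEq S b

  data DBψ : Set where
    bound : BPrefix → DerivedRel → DBψ
    _∨ψ_  : DBψ → DBψ → DBψ

  data DBφ : Set where
    pref  : QPrefix → DBψ → DBφ
    _∧φ_  : DBφ → DBφ → DBφ
    _∨φ_  : DBφ → DBφ → DBφ

  ⟦_⟧b : BoolComb → Formula
  ⟦ atom r ⟧b = rel r
  ⟦ ¬b b ⟧b = ¬' ⟦ b ⟧b
  ⟦ b ∧b c ⟧b = ⟦ b ⟧b ∧' ⟦ c ⟧b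
  ⟦ b ∨b c ⟧b = ⟦ b ⟧b ∨' ⟦ c ⟧b

  applyB : List (Args × Var) → Formula → Formula
  applyB [] φ = φ
  applyB ((a , x) ∷ w) φ = bind a x (applyB w φ)

  applyQ : List (Q × Var) → Formula → Formula
  applyQ [] φ = φ
  applyQ ((∃q , x) ∷ w) φ = ∃' x (applyQ w φ)
  applyQ ((∀q , x) ∷ w) φ = ∀' x (applyQ w φ)

  ⟦_⟧ψ : DBψ → Formula
  ⟦ bound ♭ r̄ ⟧ψ = applyB (proj₁ ♭) ⟦ proj₁ r̄ ⟧b
  ⟦ ψ ∨ψ ψ' ⟧ψ = ⟦ ψ ⟧ψ ∨' ⟦ ψ' ⟧ψ

  ⟦_⟧ : DBφ → Formula
  ⟦ pref ℘ ψ ⟧ = applyQ (proj₁ ℘) ⟦ ψ ⟧ψ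
  ⟦ φ ∧φ φ' ⟧ = ⟦ φ ⟧ ∧' ⟦ φ' ⟧
  ⟦ φ ∨φ φ' ⟧ = ⟦ φ ⟧ ∨' ⟦ φ' ⟧

module Submission where

-- Over the signature with a single relation r whose arguments are {a₀, a₁},
-- the DBFOL sentence
--     ∀x∀y∀z. (a₀,x)(a₁,y)¬r ∨ (a₀,y)(a₁,z)¬r ∨ (a₀,x)(a₁,z)r
--   ∧ ∀x. (a₀,x)(a₁,x)¬r
--   ∧ ∀x∃y. (a₀,x)(a₁,y)r
-- says that r, read as a binary relation, is a serial strict order.

open import Defs
open import Data.Product using (Σ; ∃; _×_; _,_; proj₁; proj₂)
open import Data.Sum using (_⊎_; inj₁; inj₂; [_,_])
import Data.Sum as Sum
open import Data.Empty using (⊥-elim)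
open import Data.Nat using (ℕ; zero; suc; _<_; _<?_; s≤s; z≤n)
open import Data.Nat.Properties using (<-cmp; <-trans; <-irrefl; n<1+n; m<1+n⇒m<n∨m≡n; ≤⇒≯)
open import Data.Fin using (Fin; toℕ)
import Data.Fin as F
open import Data.Fin.Properties using (toℕ-injective; injective⇒≤)
open import Data.Fin.Subset using (⊤) renaming (_∈_ to _∈ˢ_)
open import Data.Fin.Subset.Properties using (∈⊤)
open import Data.Maybe using (just)
open import Data.Maybe.Properties using (just-injective)
open import Data.List using (List; []; _∷_; map)
open import Data.List.Membership.Propositional using (_∈_; _∉_)
open import Data.List.Relation.Unary.Any using (here; there)
open import Data.List.Relation.Unary.All using ([]; _∷_)
open import Data.List.Relation.Unary.AllPairs using ([]; _∷_)
open import Data.List.Relation.Binary.Subset.Propositional using (_⊆_)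
open import Relation.Nullary using (¬_; yes; no)
open import Relation.Nullary.Decidable using (map′)
open import Relation.Binary.Definitions using (Decidable; tri<; tri≈; tri>)
open import Relation.Binary.PropositionalEquality using (_≡_; _≢_; refl; sym; trans; cong; subst)
open import Function using (_∘_)
open import Function.Definitions using (Injective)
open import Function.Bundles using (_⇔_; mk⇔; Equivalence; Injection)
open import Function.Properties.Inverse using (↔⇒↣)

-- 1. A syntactic criterion for DBFOL sentences

module Scoping (Sg : Signature) where

  ∉-∷ : ∀ {A : Set} {v x : A} {xs : List A} → v ≢ x → v ∉ xs → v ∉ x ∷ xs
  ∉-∷ v≢x v∉xs (here v≡x) = v≢x v≡x
  ∉-∷ v≢x v∉xs (there v∈xs) = v∉xs v∈xs

  applyB-freeArg : ∀ w (φ : Formula Sg) {b} →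
    FreeArg Sg (applyB Sg w φ) b → FreeArg Sg φ b × b ∉ map proj₁ w
  applyB-freeArg [] φ h = h , λ ()
  applyB-freeArg ((a , x) ∷ w) φ (h , b≢a) =
    let hφ , b∉w = applyB-freeArg w φ h in hφ , ∉-∷ b≢a b∉w

  applyB-freeVar : ∀ w (φ : Formula Sg) {v} →
    FreeVar Sg (applyB Sg w φ) v → FreeVar Sg φ v ⊎ v ∈ map proj₂ w
  applyB-freeVar [] φ h = inj₁ h
  applyB-freeVar ((a , x) ∷ w) φ (inj₁ h) = Sum.map₂ there (applyB-freeVar w φ h)
  applyB-freeVar ((a , x) ∷ w) φ (inj₂ (v≡x , _)) = inj₂ (here v≡x)

  applyQ-freeArg : ∀ w (φ : Formula Sg) {b} → FreeArg Sg (applyQ Sg w φ) b → FreeArg Sg φ b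
  applyQ-freeArg [] φ h = h
  applyQ-freeArg ((∃q , x) ∷ w) φ h = applyQ-freeArg w φ h
  applyQ-freeArg ((∀q , x) ∷ w) φ h = applyQ-freeArg w φ h

  applyQ-freeVar : ∀ w (φ : Formula Sg) {v} →
    FreeVar Sg (applyQ Sg w φ) v → FreeVar Sg φ v × v ∉ map proj₂ w
  applyQ-freeVar [] φ h = h , λ ()
  applyQ-freeVar ((∃q , x) ∷ w) φ (h , v≢x) =
    let hφ , v∉w = applyQ-freeVar w φ h in hφ , ∉-∷ v≢x v∉w
  applyQ-freeVar ((∀q , x) ∷ w) φ (h , v≢x) =
    let hφ , v∉w = applyQ-freeVar w φ h in hφ , ∉-∷ v≢x v∉w

  boolComb-noFreeVar : ∀ b {v} → ¬ FreeVar Sg (⟦_⟧b Sg b) v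
  boolComb-noFreeVar (atom r) ()
  boolComb-noFreeVar (¬b b) = boolComb-noFreeVar b
  boolComb-noFreeVar (b ∧b c) = [ boolComb-noFreeVar b , boolComb-noFreeVar c ]
  boolComb-noFreeVar (b ∨b c) = [ boolComb-noFreeVar b , boolComb-noFreeVar c ]

  ScopedIn : List Var → DBψ Sg → Set
  ScopedIn vs (bound ♭ r̄) =
    (∀ b → FreeArg Sg (⟦_⟧b Sg (proj₁ r̄)) b → b ∈ map proj₁ (proj₁ ♭))
    × map proj₂ (proj₁ ♭) ⊆ vs
  ScopedIn vs (ψ ∨ψ ψ') = ScopedIn vs ψ × ScopedIn vs ψ'

  Scoped : DBφ Sg → Set
  Scoped (pref ℘ ψ) = ScopedIn (map proj₂ (proj₁ ℘)) ψ
  Scoped (φ ∧φ φ') = Scoped φ × Scoped φ'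
  Scoped (φ ∨φ φ') = Scoped φ × Scoped φ'

  scopedIn-noFreeArg : ∀ {vs} ψ → ScopedIn vs ψ → ∀ b → ¬ FreeArg Sg (⟦_⟧ψ Sg ψ) b
  scopedIn-noFreeArg (bound ♭ r̄) (args-bound , _) b h =
    let hr̄ , b∉♭ = applyB-freeArg (proj₁ ♭) _ h in b∉♭ (args-bound b hr̄)
  scopedIn-noFreeArg (ψ ∨ψ ψ') (s , s') b =
    [ scopedIn-noFreeArg ψ s b , scopedIn-noFreeArg ψ' s' b ]

  scopedIn-freeVar : ∀ {vs} ψ → ScopedIn vs ψ → ∀ {v} → FreeVar Sg (⟦_⟧ψ Sg ψ) v → v ∈ vs
  scopedIn-freeVar (bound ♭ r̄) (_ , vars-quantified) h =
    [ ⊥-elim ∘ boolComb-noFreeVar (proj₁ r̄) , vars-quantified ] (applyB-freeVar (proj₁ ♭) _ h)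
  scopedIn-freeVar (ψ ∨ψ ψ') (s , s') =
    [ scopedIn-freeVar ψ s , scopedIn-freeVar ψ' s' ]

  sentence-⊎ : ∀ (φ φ' : Formula Sg) → IsSentence Sg φ → IsSentence Sg φ' →
    (∀ a → ¬ (FreeArg Sg φ a ⊎ FreeArg Sg φ' a)) × (∀ x → ¬ (FreeVar Sg φ x ⊎ FreeVar Sg φ' x))
  sentence-⊎ _ _ (na , nv) (na' , nv') = (λ a → [ na a , na' a ]) , (λ x → [ nv x , nv' x ])

  scoped⇒sentence : ∀ φ → Scoped φ → IsSentence Sg (⟦_⟧ Sg φ)
  scoped⇒sentence (pref ℘ ψ) s =
      (λ b h → scopedIn-noFreeArg ψ s b (applyQ-freeArg (proj₁ ℘) _ h))
    , (λ v h → let hψ , v∉℘ = applyQ-freeVar (proj₁ ℘) _ h in v∉℘ (scopedIn-freeVar ψ s hψ))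
  scoped⇒sentence (φ ∧φ φ') (s , s') =
    sentence-⊎ (⟦_⟧ Sg φ) (⟦_⟧ Sg φ') (scoped⇒sentence φ s) (scoped⇒sentence φ' s')
  scoped⇒sentence (φ ∨φ φ') (s , s') =
    sentence-⊎ (⟦_⟧ Sg φ) (⟦_⟧ Sg φ') (scoped⇒sentence φ s) (scoped⇒sentence φ' s')

-- 2. Serial strict orders live only on infinite types

record SerialStrictOrder {D : Set} (_≺_ : D → D → Set) : Set where
  field
    ≺-trans  : ∀ {x y z} → x ≺ y → y ≺ z → x ≺ z
    ≺-irrefl : ∀ x → ¬ x ≺ x
    ≺-serial : ∀ x → ∃ (x ≺_)

module _ {D : Set} {_≺_ : D → D → Set} (d : D) (order : SerialStrictOrder _≺_) where
  open SerialStrictOrder order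

  chain : ℕ → D
  chain zero = d
  chain (suc k) = proj₁ (≺-serial (chain k))

  chain-increasing : ∀ {i j} → i < j → chain i ≺ chain j
  chain-increasing {i} {suc j} i<1+j with m<1+n⇒m<n∨m≡n i<1+j
  ... | inj₁ i<j = ≺-trans (chain-increasing i<j) (proj₂ (≺-serial (chain j)))
  ... | inj₂ refl = proj₂ (≺-serial (chain i))

  -- By irreflexivity, an increasing chain never repeats.
  chain-injective : Injective _≡_ _≡_ chain
  chain-injective {i} {j} ci≡cj with <-cmp i j
  ... | tri< i<j _ _ = ⊥-elim (≺-irrefl (chain j) (subst (_≺ chain j) ci≡cj (chain-increasing i<j)))
  ... | tri≈ _ i≡j _ = i≡j
  ... | tri> _ _ j<i = ⊥-elim (≺-irrefl (chain j) (subst (chain j ≺_) ci≡cj (chain-increasing j<i)))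

  -- Restricting the chain to Fin (suc n) shows D does not inject into Fin n.
  serialStrictOrder⇒infinite : ∀ {n} (f : D → Fin n) → ¬ Injective _≡_ _≡_ f
  serialStrictOrder⇒infinite {n} f f-inj = ≤⇒≯ (injective⇒≤ restricted-injective) (n<1+n n)
    where
    restricted-injective : Injective _≡_ _≡_ (f ∘ chain ∘ toℕ {suc n})
    restricted-injective = toℕ-injective ∘ chain-injective ∘ f-inj

-- 3. One binary relation: models of the serial-strict-order axiom

Sig : Signature
Sig = record { nA = 2 ; nR = 1 ; Args-nonempty = s≤s z≤n ; Rels-nonempty = s≤s z≤n
             ; ar = λ _ → ⊤ ; ar-nonempty = λ _ → F.zero , ∈⊤ }

pattern a₀ = F.zero
pattern a₁ = F.suc F.zero

r : Rels Sig
r = F.zero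

Holds : (R : Structure Sig) → Structure.D R → Structure.D R → Set
Holds R x y = Σ ((a : Args Sig) → a ∈ˢ ⊤ → Structure.D R) λ f →
  Structure.rel R r f × (∀ p → f a₀ p ≡ x) × (∀ p → f a₁ p ≡ y)

bindPair : Var → Var → BPrefix Sig
bindPair x y = ((a₀ , x) ∷ (a₁ , y) ∷ []) , ((λ ()) ∷ []) ∷ [] ∷ []

pos neg : DerivedRel Sig
pos = atom r , ⊤ , refl
neg = ¬b (atom r) , ⊤ , refl

infix 25 _≺ᵈ_ _⊀ᵈ_
_≺ᵈ_ _⊀ᵈ_ : Var → Var → DBψ Sig
x ≺ᵈ y = bound (bindPair x y) pos
x ⊀ᵈ y = bound (bindPair x y) neg

transitivity irreflexivity seriality serialStrictOrderAxiom : DBφ Sig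
transitivity = pref (((∀q , 0) ∷ (∀q , 1) ∷ (∀q , 2) ∷ []) ,
                     ((λ ()) ∷ (λ ()) ∷ []) ∷ ((λ ()) ∷ []) ∷ [] ∷ [])
                    ((0 ⊀ᵈ 1 ∨ψ 1 ⊀ᵈ 2) ∨ψ 0 ≺ᵈ 2)
irreflexivity = pref (((∀q , 0) ∷ []) , [] ∷ []) (0 ⊀ᵈ 0)
seriality = pref (((∀q , 0) ∷ (∃q , 1) ∷ []) , ((λ ()) ∷ []) ∷ [] ∷ []) (0 ≺ᵈ 1)
serialStrictOrderAxiom = transitivity ∧φ (irreflexivity ∧φ seriality)

open Scoping Sig using (ScopedIn; scoped⇒sentence)

bindPair-scoped : ∀ {vs x y} r̄ → x ∈ vs → y ∈ vs → ScopedIn vs (bound (bindPair x y) r̄)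
bindPair-scoped r̄ x∈vs y∈vs = pair-covers , λ { (here refl) → x∈vs ; (there (here refl)) → y∈vs }
  where pair-covers : ∀ b → FreeArg Sig (⟦_⟧b Sig (proj₁ r̄)) b → b ∈ a₀ ∷ a₁ ∷ []
        pair-covers a₀ _ = here refl
        pair-covers a₁ _ = there (here refl)

-- All five bound relations use only quantified variables among 0, 1, 2.
serialStrictOrderAxiom-sentence : IsSentence Sig (⟦_⟧ Sig serialStrictOrderAxiom)
serialStrictOrderAxiom-sentence = scoped⇒sentence serialStrictOrderAxiom
  ( ((bindPair-scoped neg x₀ x₁ , bindPair-scoped neg x₁ x₂) , bindPair-scoped pos x₀ x₂)
  , bindPair-scoped neg x₀ x₀
  , bindPair-scoped pos x₀ x₁ )
  where x₀ : ∀ {vs} → 0 ∈ 0 ∷ vs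
        x₀ = here refl
        x₁ : ∀ {vs} → 1 ∈ 0 ∷ 1 ∷ vs
        x₁ = there (here refl)
        x₂ : 2 ∈ 0 ∷ 1 ∷ 2 ∷ []
        x₂ = there (there (here refl))

module _ (R : Structure Sig) where
  open Structure R using (D)
  open Equivalence using (to; from)

  bindPair-atom⇔ : ∀ (χ : Assignment Sig D) x y {dx dy} →
    Assignment.onVars χ x ≡ just dx → Assignment.onVars χ y ≡ just dy →
    _,_⊨_ Sig R χ (⟦_⟧ψ Sig (x ≺ᵈ y)) ⇔ Holds R dx dy
  bindPair-atom⇔ χ x y χx χy = mk⇔
    (λ (f , rf , χ≡f) → f , rf , (λ p → value (χ≡f a₀ p) χx) , (λ p → value (χ≡f a₁ p) χy))
    (λ (f , rf , f₀ , f₁) → f , rf , λ { a₀ p → trans χx (cong just (sym (f₀ p)))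
                                       ; a₁ p → trans χy (cong just (sym (f₁ p))) })
    where value : ∀ {m} {d e : D} → m ≡ just d → m ≡ just e → d ≡ e
          value m≡d m≡e = just-injective (trans (sym m≡d) m≡e)

  -- The assignments produced by the quantifier prefixes of the axioms.
  assign₁ : D → Assignment Sig D
  assign₁ x = updVar Sig (emptyAssignment Sig) 0 (just x)
  assign₂ : D → D → Assignment Sig D
  assign₂ x y = updVar Sig (assign₁ x) 1 (just y)
  assign₃ : D → D → D → Assignment Sig D
  assign₃ x y z = updVar Sig (assign₂ x y) 2 (just z)

  model⇒serialStrictOrder : IsModel Sig R (⟦_⟧ Sig serialStrictOrderAxiom) →
    SerialStrictOrder (Holds R)
  model⇒serialStrictOrder (transitive , irreflexive , serial) = record
    { ≺-trans = holds-trans ; ≺-irrefl = holds-irrefl ; ≺-serial = holds-serial }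
    where
    holds-trans : ∀ {x y z} → Holds R x y → Holds R y z → Holds R x z
    holds-trans {x} {y} {z} x≺y y≺z with transitive x y z
    ... | inj₁ (inj₁ x⊀y) = ⊥-elim (x⊀y (from (bindPair-atom⇔ (assign₃ x y z) 0 1 refl refl) x≺y))
    ... | inj₁ (inj₂ y⊀z) = ⊥-elim (y⊀z (from (bindPair-atom⇔ (assign₃ x y z) 1 2 refl refl) y≺z))
    ... | inj₂ x≺z = to (bindPair-atom⇔ (assign₃ x y z) 0 2 refl refl) x≺z
    holds-irrefl : ∀ x → ¬ Holds R x x
    holds-irrefl x = irreflexive x ∘ from (bindPair-atom⇔ (assign₁ x) 0 0 refl refl)
    holds-serial : ∀ x → ∃ (Holds R x)
    holds-serial x = let y , x≺y = serial x in y , to (bindPair-atom⇔ (assign₂ x y) 0 1 refl refl) x≺y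

  serialStrictOrder⇒model : Decidable (Holds R) → SerialStrictOrder (Holds R) →
    IsModel Sig R (⟦_⟧ Sig serialStrictOrderAxiom)
  serialStrictOrder⇒model holds? order = transitive , irreflexive , serial
    where
    open SerialStrictOrder order
    transitive : IsModel Sig R (⟦_⟧ Sig transitivity)
    transitive x y z with holds? x y | holds? y z
    ... | no x⊀y | _ = inj₁ (inj₁ (x⊀y ∘ to (bindPair-atom⇔ (assign₃ x y z) 0 1 refl refl)))
    ... | yes _ | no y⊀z = inj₁ (inj₂ (y⊀z ∘ to (bindPair-atom⇔ (assign₃ x y z) 1 2 refl refl)))
    ... | yes x≺y | yes y≺z = inj₂ (from (bindPair-atom⇔ (assign₃ x y z) 0 2 refl refl) (≺-trans x≺y y≺z))
    irreflexive : IsModel Sig R (⟦_⟧ Sig irreflexivity)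
    irreflexive x = ≺-irrefl x ∘ to (bindPair-atom⇔ (assign₁ x) 0 0 refl refl)
    serial : IsModel Sig R (⟦_⟧ Sig seriality)
    serial x = let y , x≺y = ≺-serial x in y , from (bindPair-atom⇔ (assign₂ x y) 0 1 refl refl) x≺y

-- 4. The natural numbers with < satisfy the axiom

ℕ< : Structure Sig
ℕ< = record { D = ℕ ; inhabited = 0 ; rel = λ _ f → f a₀ ∈⊤ < f a₁ ∈⊤ }

<⇔Holds : ∀ {m n} → m < n ⇔ Holds ℕ< m n
<⇔Holds {m} {n} = mk⇔ (λ m<n → pair , m<n , (λ _ → refl) , (λ _ → refl))
                      (λ { (f , f₀<f₁ , f₀≡m , f₁≡n) → respect (f₀≡m ∈⊤) (f₁≡n ∈⊤) f₀<f₁ })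
  where
  pair : (a : Args Sig) → a ∈ˢ ⊤ → ℕ
  pair a₀ _ = m
  pair a₁ _ = n
  respect : ∀ {i j} → i ≡ m → j ≡ n → i < j → m < n
  respect refl refl i<j = i<j

ℕ<-model : IsModel Sig ℕ< (⟦_⟧ Sig serialStrictOrderAxiom)
ℕ<-model = serialStrictOrder⇒model ℕ<
  (λ m n → map′ (to <⇔Holds) (from <⇔Holds) (m <? n))
  (record { ≺-trans  = λ h h' → to <⇔Holds (<-trans (from <⇔Holds h) (from <⇔Holds h'))
          ; ≺-irrefl = λ m → <-irrefl refl ∘ from <⇔Holds
          ; ≺-serial = λ m → suc m , to <⇔Holds (n<1+n m) })
  where open Equivalence using (to; from)

mainTheorem2 : Σ Signature λ Sig → Σ (DBφ Sig) λ φ →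
    IsSentence Sig (⟦_⟧ Sig φ) × Satisfiable Sig (⟦_⟧ Sig φ)
    × ¬ HasFiniteModel Sig (⟦_⟧ Sig φ)
mainTheorem2 = Sig , serialStrictOrderAxiom , serialStrictOrderAxiom-sentence
             , (ℕ< , ℕ<-model) , no-finite-model
  where
  no-finite-model : ¬ HasFiniteModel Sig (⟦_⟧ Sig serialStrictOrderAxiom)
  no-finite-model (R , (n , D↔Fin) , model) =
    serialStrictOrder⇒infinite (Structure.inhabited R) (model⇒serialStrictOrder R model)
      (Injection.to (↔⇒↣ D↔Fin)) (Injection.injective (↔⇒↣ D↔Fin))
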